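{- Let $(N_1,C_1)$ and $(N_2,C_2)$ be coherent nets and $E$ a Presburger formula with free variables in $P_1\cup P_2$, and suppose $(N_1,C_1)\preceq_E(N_2,C_2)$. Then for every pair of markings $m_1\in\mathbb N^{P_1}$, $m_2\in\mathbb N^{P_2}$ such that $m_1\models C_1$, $m_1\equiv_E m_2$ and $m_2\models C_2$, we have $(N_1,m_1)\sqsubseteq_E(N_2,m_2)$.
   Context: A labeled Petri net $N=(P,T,\mathrm{Pre},\mathrm{Post})$ consists of a finite set of places $P$, a finite set of transitions $T$ disjoint from $P$, functions $\mathrm{Pre},\mathrm{Post}:T\to(P\to\mathbb N)$, and a labeling $l:T\to\Sigma\cup\{\tau\}$, where $\Sigma$ is an alphabet and $\tau\notin\Sigma$ is the silent action. A marking is a map $m:P\to\mathbb N$. Transition $t$ is enabled at $m$ if $m(p)\ge\mathrm{Pre}(t,p)$ for all $p$, and then $m\xrightarrow{t}m'$ with $m'=m-\mathrm{Pre}(t)+\mathrm{Post}(t)$. For $\varrho=t_1\cdots t_n\in T^*$, $m\xRightarrow{\varrho}m'$ means there are markings $m=m_0,\dots,m_n=m'$ with $m_i\xrightarrow{t_{i+1}}m_{i+1}$. Extend $l$ to sequences by erasing silent transitions ($l(\epsilon)=\epsilon$, $l(\varrho t)=l(\varrho)$ if $l(t)=\tau$, else $l(\varrho)l(t)$). For $\sigma\in\Sigma^*$, $m\xRightarrow{\sigma}m'$ means there is $\varrho$ with $m\xRightarrow{\varrho}m'$ and $l(\varrho)=\sigma$; in particular $m\xRightarrow{\epsilon}m'$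 means $m'$ is reached by a (possibly empty) sequence of silent transitions. Define $m\overset{\sigma}{\twoheadrightarrow}m'$ by: $m\overset{\epsilon}{\twoheadrightarrow}m'$ iff $m'=m$; and for $\sigma\in\Sigma^*$, $a\in\Sigma$, $m\overset{\sigma a}{\twoheadrightarrow}m'$ iff there exist a marking $m''$ and a transition $t$ with $l(t)=a$ and $m\xRightarrow{\sigma}m''\xrightarrow{t}m'$. A coherency constraint $C$ for $N$ is a Presburger formula over the places of $N$, viewed as a set of markings. $(N,C)$ is a coherent net if for every $m\models C$, $\sigma\in\Sigma^*$ and $m'$ with $m\xRightarrow{\sigma}m'$, there exists $m''\models C$ with $m\overset{\sigma}{\twoheadrightarrow}m''$ and $m''\xRightarrow{\epsilon}m'$. For nets $N_1,N_2$ with place sets $P_1,P_2$ (possibly sharing places), a Presburger formula $E$ with free variables in $P_1\cup P_2$, and markings $m_1\in\mathbb N^{P_1}$, $m_2\in\mathbb N^{P_2}$: $m_1\equiv_E m_2$ means $m_1,m_2$ agree on $P_1\cap P_2$ and the assignment $m_1\cup m_2$ satisfies $E$ over $\mathbb N$. Write $m_1\langle C_1EC_2\rangle m_2$ for ($m_1\models C_1$ and $m_1\equiv_E m_2$ and $m_2\models C_2$). $(N_1,C_1)\preceq_E(N_2,C_2)$ (parametric $E$-abstraction) means: (S1) for every $m_1\models C_1$ there is $m_2$ with $m_1\langle C_1EC_2\rangle m_2$; (S2) for all $m_1\xRightarrow{\epsilon}m_1'$ in $N_1$ and all $m_2$, $m_1\equiv_E m_2$ implies $m_1'\equiv_E m_2$;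 (S3) for all $\sigma\in\Sigma^*$, all $m_1\xRightarrow{\sigma}m_1'$ in $N_1$ and all $m_2,m_2'$, if $m_1\langle C_1EC_2\rangle m_2$ and $m_1'\equiv_E m_2'$ then $m_2\xRightarrow{\sigma}m_2'$ in $N_2$. $(N_1,m_1)\sqsubseteq_E(N_2,m_2)$ ($E$-abstraction of marked nets) means: (A1) $m_1\equiv_E m_2$; (A2) for every $(N_1,m_1)\xRightarrow{\sigma}(N_1,m_1')$ there is at least one $m_2'$ with $m_1'\equiv_E m_2'$, and for every $m_2'$ with $m_1'\equiv_E m_2'$ we have $(N_2,m_2)\xRightarrow{\sigma}(N_2,m_2')$. -}

module Defs where

open import Data.Nat using (ℕ; _+_; _∸_; _≤_)
open import Data.Fin using (Fin)
open import Data.Bool using (Bool; true; false; T; _∨_)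
open import Data.Unit using (tt)
open import Data.Maybe using (Maybe; just; nothing)
open import Data.List using (List; []; _∷_; _∷ʳ_)
open import Data.Product using (Σ; _×_; _,_; ∃)
open import Data.Sum using (_⊎_)
open import Relation.Nullary using (¬_)
open import Relation.Binary.PropositionalEquality using (_≡_; subst; sym)

-- Presburger arithmetic (syntax and semantics over ℕ)
-- Bound variables are handled de Bruijn-style via Maybe.

data Term (V : Set) : Set where
  var   : V → Term V
  const : ℕ → Term V
  _⊕_   : Term V → Term V → Term V

data Formula (V : Set) : Set where
  _≤ₚ_ : Term V → Term V → Formula V
  _=ₚ_ : Term V → Term V → Formula V
  ¬ₚ_  : Formula V → Formula V
  _∧ₚ_ : Formula V → Formula V → Formula V
  _∨ₚ_ : Formula V → Formula V → Formula V
  ∃ₚ   : Formula (Maybe V) → Formula V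
  ∀ₚ   : Formula (Maybe V) → Formula V

extend : {V : Set} → (V → ℕ) → ℕ → Maybe V → ℕ
extend ρ k nothing  = k
extend ρ k (just v) = ρ v

evalT : {V : Set} → Term V → (V → ℕ) → ℕ
evalT (var v)   ρ = ρ v
evalT (const k) ρ = k
evalT (s ⊕ t)   ρ = evalT s ρ + evalT t ρ

⟦_⟧ : {V : Set} → Formula V → (V → ℕ) → Set
⟦ s ≤ₚ t ⟧ ρ = evalT s ρ ≤ evalT t ρ
⟦ s =ₚ t ⟧ ρ = evalT s ρ ≡ evalT t ρ
⟦ ¬ₚ φ ⟧   ρ = ¬ (⟦ φ ⟧ ρ)
⟦ φ ∧ₚ ψ ⟧ ρ = ⟦ φ ⟧ ρ × ⟦ ψ ⟧ ρ
⟦ φ ∨ₚ ψ ⟧ ρ = ⟦ φ ⟧ ρ ⊎ ⟦ ψ ⟧ ρ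
⟦ ∃ₚ φ ⟧   ρ = Σ ℕ (λ k → ⟦ φ ⟧ (extend ρ k))
⟦ ∀ₚ φ ⟧   ρ = (k : ℕ) → ⟦ φ ⟧ (extend ρ k)

-- Places: a finite universe Fin n of place names; a place set is a
-- (decidable) subset P : Fin n → Bool.  Nets may share places.

PlaceSet : ℕ → Set
PlaceSet n = Fin n → Bool

Place : {n : ℕ} → PlaceSet n → Set
Place P = Σ (Fin _) (λ p → T (P p))

Marking : {n : ℕ} → PlaceSet n → Set
Marking P = Place P → ℕ

_∪ₚ_ : {n : ℕ} → PlaceSet n → PlaceSet n → PlaceSet n
(P₁ ∪ₚ P₂) p = P₁ p ∨ P₂ p

_≗_ : {n : ℕ} {P : PlaceSet n} → Marking P → Marking P → Set
m ≗ m' = ∀ q → m q ≡ m' q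

-- Labeled Petri nets over alphabet A; label nothing = silent action τ.

record Net (A : Set) {n : ℕ} (P : PlaceSet n) : Set where
  field
    nT    : ℕ
    Pre   : Fin nT → Marking P
    Post  : Fin nT → Marking P
    label : Fin nT → Maybe A

module _ {A : Set} {n : ℕ} {P : PlaceSet n} (N : Net A P) where
  open Net N

  Trans : Set
  Trans = Fin nT

  Step : Marking P → Trans → Marking P → Set
  Step m t m' = (∀ q → Pre t q ≤ m q) × (∀ q → m' q ≡ m q ∸ Pre t q + Post t q)

  data Run : Marking P → List Trans → Marking P → Set where
    done : ∀ {m} → Run m [] m
    step : ∀ {m m'' m' t ρ} → Step m t m'' → Run m'' ρ m' → Run m (t ∷ ρ) m'

  labels : List Trans → List A
  labels [] = []
  labels (t ∷ ρ) with label t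
  ... | nothing = labels ρ
  ... | just a  = a ∷ labels ρ

  Reach : Marking P → List A → Marking P → Set
  Reach m σ m' = ∃ (λ ρ → Run m ρ m' × labels ρ ≡ σ)

  data Reach↠ : Marking P → List A → Marking P → Set where
    ε↠   : ∀ {m m'} → m' ≗ m → Reach↠ m [] m'
    snoc : ∀ {m m'' m' σ a} (t : Trans) → Reach m σ m'' → Step m'' t m' →
           label t ≡ just a → Reach↠ m (σ ∷ʳ a) m'

  Coherent : Formula (Place P) → Set
  Coherent C = ∀ (m : Marking P) → ⟦ C ⟧ m → ∀ (σ : List A) (m' : Marking P) →
    Reach m σ m' → Σ (Marking P) (λ m'' → ⟦ C ⟧ m'' × Reach↠ m σ m'' × Reach m'' [] m')

module _ {n : ℕ} {P₁ P₂ : PlaceSet n} where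

  -- the assignment m₁ ∪ m₂ on P₁ ∪ P₂ (m₁ takes precedence on shared
  -- places, where both agree anyway whenever it is used)
  union : Marking P₁ → Marking P₂ → Marking (P₁ ∪ₚ P₂)
  union m₁ m₂ (p , h) with P₁ p in eq
  ... | true  = m₁ (p , subst T (sym eq) tt)
  ... | false = m₂ (p , h)

  Agree : Marking P₁ → Marking P₂ → Set
  Agree m₁ m₂ = ∀ p (h₁ : T (P₁ p)) (h₂ : T (P₂ p)) → m₁ (p , h₁) ≡ m₂ (p , h₂)

  EqE : Formula (Place (P₁ ∪ₚ P₂)) → Marking P₁ → Marking P₂ → Set
  EqE E m₁ m₂ = Agree m₁ m₂ × ⟦ E ⟧ (union m₁ m₂)

  Rel : Formula (Place P₁) → Formula (Place (P₁ ∪ₚ P₂)) → Formula (Place P₂) →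
        Marking P₁ → Marking P₂ → Set
  Rel C₁ E C₂ m₁ m₂ = ⟦ C₁ ⟧ m₁ × EqE E m₁ m₂ × ⟦ C₂ ⟧ m₂

module _ {A : Set} {n : ℕ} {P₁ P₂ : PlaceSet n} where

  record ParamAbstraction (N₁ : Net A P₁) (C₁ : Formula (Place P₁))
         (E : Formula (Place (P₁ ∪ₚ P₂)))
         (N₂ : Net A P₂) (C₂ : Formula (Place P₂)) : Set where
    field
      S1 : ∀ (m₁ : Marking P₁) → ⟦ C₁ ⟧ m₁ →
           Σ (Marking P₂) (λ m₂ → Rel C₁ E C₂ m₁ m₂)
      S2 : ∀ (m₁ m₁' : Marking P₁) (m₂ : Marking P₂) →
           Reach N₁ m₁ [] m₁' → EqE E m₁ m₂ → EqE E m₁' m₂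
      S3 : ∀ (σ : List A) (m₁ m₁' : Marking P₁) (m₂ m₂' : Marking P₂) →
           Reach N₁ m₁ σ m₁' → Rel C₁ E C₂ m₁ m₂ → EqE E m₁' m₂' →
           Reach N₂ m₂ σ m₂'

  record MarkedAbstraction (N₁ : Net A P₁) (m₁ : Marking P₁)
         (E : Formula (Place (P₁ ∪ₚ P₂)))
         (N₂ : Net A P₂) (m₂ : Marking P₂) : Set where
    field
      A1 : EqE E m₁ m₂
      A2 : ∀ (σ : List A) (m₁' : Marking P₁) → Reach N₁ m₁ σ m₁' →
           Σ (Marking P₂) (λ m₂' → EqE E m₁' m₂') ×
           (∀ (m₂' : Marking P₂) → EqE E m₁' m₂' → Reach N₂ m₂ σ m₂')

module Submission where

open import Defs
open import Data.Nat using (ℕ)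
open import Data.List using (List)
open import Data.Product using (Σ; _×_; _,_)

-- Every marking reachable from C₁ passes, just before its trailing silent
-- steps, through a marking in C₁ (coherence); S1 relates that marking to
-- some marking of N₂, and S2 carries the relation along the silent steps.
-- The universal half of A2 is S3 itself.

module _ {A : Set} {n : ℕ} {P₁ P₂ : PlaceSet n}
         {N₁ : Net A P₁} {C₁ : Formula (Place P₁)}
         {N₂ : Net A P₂} {C₂ : Formula (Place P₂)}
         {E : Formula (Place (P₁ ∪ₚ P₂))}
         (abs : ParamAbstraction N₁ C₁ E N₂ C₂) where
  open ParamAbstraction abs

  reachable-has-E-partner : Coherent N₁ C₁ →
    ∀ {m₁ m₁' : Marking P₁} {σ : List A} → ⟦ C₁ ⟧ m₁ → Reach N₁ m₁ σ m₁' →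
    Σ (Marking P₂) (λ m₂' → EqE E m₁' m₂')
  reachable-has-E-partner coh {m₁} {m₁'} {σ} c₁ r
    with coh m₁ c₁ σ m₁' r
  ... | m , cₘ , _ , silent with S1 m cₘ
  ...   | m₂' , _ , eₘ , _ = m₂' , S2 m m₁' m₂' silent eₘ

  marked-abstraction : Coherent N₁ C₁ →
    ∀ {m₁ : Marking P₁} {m₂ : Marking P₂} →
    Rel C₁ E C₂ m₁ m₂ → MarkedAbstraction N₁ m₁ E N₂ m₂
  marked-abstraction coh {m₁} {m₂} rel@(c₁ , e , _) = record
    { A1 = e
    ; A2 = λ σ m₁' r → reachable-has-E-partner coh c₁ r
                     , λ m₂' e' → S3 σ m₁ m₁' m₂ m₂' r rel e'
    }

theorem2 : ∀ {A : Set} {n : ℕ} {P₁ P₂ : PlaceSet n}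
    (N₁ : Net A P₁) (C₁ : Formula (Place P₁))
    (N₂ : Net A P₂) (C₂ : Formula (Place P₂))
    (E : Formula (Place (P₁ ∪ₚ P₂))) →
    Coherent N₁ C₁ → Coherent N₂ C₂ →
    ParamAbstraction N₁ C₁ E N₂ C₂ →
    ∀ (m₁ : Marking P₁) (m₂ : Marking P₂) →
    ⟦ C₁ ⟧ m₁ → EqE E m₁ m₂ → ⟦ C₂ ⟧ m₂ →
    MarkedAbstraction N₁ m₁ E N₂ m₂
theorem2 N₁ C₁ N₂ C₂ E coh₁ _ abs m₁ m₂ c₁ e c₂ =
  marked-abstraction abs coh₁ (c₁ , e , c₂)
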